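{- Let $\mathcal{D}$ be a symmetric design with parameters $(n,k,\lambda)$ on the point set $[n]$. Then the blocks of $\mathcal{D}$ form a resolving set for the Johnson graph $J(n,k)$.
   Context: A 2-design with parameters $(n,k,\lambda)$, $n>k$, is a pair $([n],\mathcal{B})$ where $\mathcal{B}$ is a family of $k$-subsets of $[n]=\{1,\dots,n\}$ (blocks) such that every pair of distinct points lies in exactly $\lambda$ blocks; it is symmetric if $|\mathcal{B}|=n$. The Johnson graph $J(n,k)$ has as vertices the $k$-subsets of $[n]$, adjacent when their intersection has size $k-1$. A resolving set is a set $\mathcal{S}$ of vertices such that for all distinct vertices $U,W$ some $X\in\mathcal{S}$ has $d(U,X)\neq d(W,X)$. -}

module Defs where

open import Data.Nat using (ℕ; zero; suc; _∸_; _<_)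
open import Data.Fin using (Fin)
open import Data.Fin.Subset using (Subset; _∈_; _∩_; ∣_∣)
open import Data.Fin.Subset.Properties using (_∈?_)
open import Data.Vec using (tabulate)
open import Data.Bool using (Bool)
open import Data.Product using (_×_; ∃-syntax)
open import Relation.Nullary using (¬_; does)
open import Relation.Nullary.Decidable using (_×-dec_)
open import Relation.Binary.PropositionalEquality using (_≡_)
open import Function.Definitions using (Injective)

pairCount : {n b : ℕ} → (Fin b → Subset n) → Fin n → Fin n → ℕ
pairCount B x y = ∣ tabulate (λ i → does ((x ∈? B i) ×-dec (y ∈? B i))) ∣

-- A 2-(n,k,λ) design whose blocks are given as an injective family
-- B : Fin b → Subset n (so the block set {B i} has exactly b elements).
record IsDesign (n k lam b : ℕ) (B : Fin b → Subset n) : Set where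
  field
    k<n         : k < n
    distinct    : Injective _≡_ _≡_ B
    blockSize   : ∀ i → ∣ B i ∣ ≡ k
    balanced    : ∀ x y → ¬ x ≡ y → pairCount B x y ≡ lam

IsSymmetricDesign : (n k lam : ℕ) → (Fin n → Subset n) → Set
IsSymmetricDesign n k lam B = IsDesign n k lam n B

IsVertex : (n k : ℕ) → Subset n → Set
IsVertex n k U = ∣ U ∣ ≡ k

Adj : (n k : ℕ) → Subset n → Subset n → Set
Adj n k U W = IsVertex n k U × IsVertex n k W × ∣ U ∩ W ∣ ≡ k ∸ 1

data Walk (n k : ℕ) : Subset n → Subset n → ℕ → Set where
  here : ∀ {U} → Walk n k U U zero
  step : ∀ {U V W m} → Adj n k U V → Walk n k V W m → Walk n k U W (suc m)

Dist : (n k : ℕ) → Subset n → Subset n → ℕ → Set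
Dist n k U W m = Walk n k U W m × (∀ m′ → m′ < m → ¬ Walk n k U W m′)

IsResolving : (n k : ℕ) → (Subset n → Set) → Set
IsResolving n k S =
  ∀ U W → IsVertex n k U → IsVertex n k W → ¬ U ≡ W →
  ∃[ X ] (S X × ∀ d₁ d₂ → Dist n k U X d₁ → Dist n k W X d₂ → ¬ d₁ ≡ d₂)

module Submission where

-- For k-subsets U and X the distance is
-- d(U,X) = k - |U ∩ X|: one edge changes |U ∩ X| by at most one, and
-- exchanging a point of U \ X for a point of X \ U is an edge that raises
-- it by exactly one.  Hence a block B separates U and W precisely when
-- |U ∩ B| ≠ |W ∩ B|.
--
-- Double counting gives, for a point x with
-- replication number r_x and any point set S,
--     Σ_{B ∋ x} |S ∩ B| + λ [x ∈ S] = r_x [x ∈ S] + λ |S|.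
-- If x ∈ U \ W for k-sets U, W with the same intersection sizes with all
-- blocks, comparing the identity for U and for W forces r_x = λ; the case
-- S = all points then forces λ = 0 (as k < n).  A symmetric design with
-- λ = 0 has n distinct singleton blocks, which cover x, so r_x ≠ 0: absurd.
-- Hence distinct k-sets meet some block in different numbers of points, and
-- the distance formula of Part 2 turns this into different distances.

open import Defs
open import Data.Nat using (ℕ; zero; suc; _+_; _*_; _∸_; _≤_; _<_; z≤n; s≤s)
open import Data.Nat.Properties
open import Data.Nat.Tactic.RingSolver using (solve-∀)
open import Algebra.Properties.Semiring.Sum +-*-semiring
  using (sum; sum-syntax; sum-cong-≗; ∑-distrib-+; ∑-comm; *-distribˡ-sum; *-distribʳ-sum;
         sum-replicate-zero)
open import Data.Fin using (Fin; zero; suc; punchOut; fromℕ<)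
  renaming (_≟_ to _≟ᶠ_)
open import Data.Fin.Properties using (¬∀⟶∃¬; punchOut-injective; injective⇒≤)
open import Data.Fin.Subset using (Subset; _∩_; ∣_∣; ⊤)
open import Data.Fin.Subset.Properties using (_∈?_; ∩-idem; ∩-comm; ∩-identityˡ; ∣⊤∣≡n; ∣p∩q∣≤∣p∣)
open import Data.Vec using ([]; _∷_; lookup; tabulate; _[_]≔_)
open import Data.Vec.Properties
  using (lookup∘tabulate; lookup-zipWith; tabulate∘lookup; tabulate-cong; lookup∘update;
         lookup∘update′; lookup-replicate)
open import Data.Bool using (Bool; true; false; _∧_)
import Data.Bool as Bool
open import Data.Product using (_×_; _,_; ∃-syntax; proj₁; proj₂)
open import Data.Sum using (_⊎_; inj₁; inj₂)
open import Data.Empty using (⊥-elim)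
open import Function using (_∘_)
open import Function.Definitions using (Injective)
open import Relation.Nullary using (¬_; does; yes; no)
open import Relation.Nullary.Decidable using (dec-true; dec-false)
open import Relation.Binary.PropositionalEquality
  using (_≡_; _≢_; refl; sym; trans; cong; cong₂; subst; subst₂; module ≡-Reasoning)

-- Part 1: finite sums over Fin n (from the standard library's semiring
-- summation) and subsets as 0/1 indicator functions.

∑-mono : ∀ {n} {f g : Fin n → ℕ} → (∀ j → f j ≤ g j) → sum f ≤ sum g
∑-mono {zero}  _   = z≤n
∑-mono {suc n} f≤g = +-mono-≤ (f≤g zero) (∑-mono (f≤g ∘ suc))

term≤∑ : ∀ {n} (f : Fin n → ℕ) j → f j ≤ sum f
term≤∑ f zero    = m≤m+n (f zero) _
term≤∑ f (suc j) = ≤-trans (term≤∑ (f ∘ suc) j) (m≤n+m _ (f zero))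

∑-rigid : ∀ {n} {f g : Fin n → ℕ} → (∀ j → f j ≤ g j) → sum f ≡ sum g → ∀ j → f j ≡ g j
∑-rigid {suc n} {f} {g} f≤g ∑f≡∑g = λ { zero → head≡ ; (suc j) → ∑-rigid (f≤g ∘ suc) tail≡ j }
  where
  ∑tail≤ : sum (f ∘ suc) ≤ sum (g ∘ suc)
  ∑tail≤ = ∑-mono (f≤g ∘ suc)
  head≡ : f zero ≡ g zero
  head≡ = ≤-antisym (f≤g zero)
    (+-cancelʳ-≤ (sum (f ∘ suc)) (g zero) (f zero)
      (≤-trans (+-monoʳ-≤ (g zero) ∑tail≤) (≤-reflexive (sym ∑f≡∑g))))
  tail≡ : sum (f ∘ suc) ≡ sum (g ∘ suc)
  tail≡ = +-cancelˡ-≡ (f zero) _ _ (trans ∑f≡∑g (cong (_+ sum (g ∘ suc)) (sym head≡)))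

[_] : Bool → ℕ
[ true ]  = 1
[ false ] = 0

[]-∧ : ∀ u v → [ u ∧ v ] ≡ [ u ] * [ v ]
[]-∧ true  true  = refl
[]-∧ true  false = refl
[]-∧ false _     = refl

[]-idem : ∀ u → [ u ] * [ u ] ≡ [ u ]
[]-idem true  = refl
[]-idem false = refl

[]-injective : ∀ {u v} → [ u ] ≡ [ v ] → u ≡ v
[]-injective {true}  {true}  _ = refl
[]-injective {false} {false} _ = refl

[]*≤ˡ : ∀ u v → [ u ] * [ v ] ≤ [ u ]
[]*≤ˡ true  true  = ≤-refl
[]*≤ˡ true  false = z≤n
[]*≤ˡ false _     = z≤n

[]*≤ʳ : ∀ u v → [ u ] * [ v ] ≤ [ v ]
[]*≤ʳ u v = subst (_≤ [ v ]) (*-comm [ v ] [ u ]) ([]*≤ˡ v u)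

δ : ∀ {n} → Fin n → Fin n → ℕ
δ a j = [ does (a ≟ᶠ j) ]

δ-same : ∀ {n} (a : Fin n) → δ a a ≡ 1
δ-same a = cong [_] (dec-true (a ≟ᶠ a) refl)

δ-other : ∀ {n} {a j : Fin n} → a ≢ j → δ a j ≡ 0
δ-other {a = a} {j} a≢j = cong [_] (dec-false (a ≟ᶠ j) a≢j)

∑-δ : ∀ {n} (a : Fin n) (f : Fin n → ℕ) → sum (λ j → δ a j * f j) ≡ f a
∑-δ {suc n} zero    f = trans (cong₂ _+_ (+-identityʳ (f zero)) (sum-replicate-zero n)) (+-identityʳ (f zero))
∑-δ {suc n} (suc a) f = ∑-δ a (f ∘ suc)

∑-+δ : ∀ {n} (a : Fin n) (f : Fin n → ℕ) → sum (λ j → f j + δ a j) ≡ sum f + 1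
∑-+δ a f = trans (∑-distrib-+ f (δ a))
  (cong (sum f +_) (trans (sum-cong-≗ (λ j → sym (*-identityʳ (δ a j)))) (∑-δ a (λ _ → 1))))

χ : ∀ {n} → Subset n → Fin n → ℕ
χ p j = [ lookup p j ]

∣p∣≡∑χ : ∀ {n} (p : Subset n) → ∣ p ∣ ≡ sum (χ p)
∣p∣≡∑χ []          = refl
∣p∣≡∑χ (true ∷ p)  = cong suc (∣p∣≡∑χ p)
∣p∣≡∑χ (false ∷ p) = ∣p∣≡∑χ p

∣p∩q∣≡∑χχ : ∀ {n} (p q : Subset n) → ∣ p ∩ q ∣ ≡ sum (λ j → χ p j * χ q j)
∣p∩q∣≡∑χχ p q = trans (∣p∣≡∑χ (p ∩ q))
  (sum-cong-≗ (λ j → trans (cong [_] (lookup-zipWith _∧_ j p q)) ([]-∧ (lookup p j) (lookup q j))))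

does-∈? : ∀ {n} (x : Fin n) p → does (x ∈? p) ≡ lookup p x
does-∈? zero    (true ∷ p)  = refl
does-∈? zero    (false ∷ p) = refl
does-∈? (suc x) (_ ∷ p)     = does-∈? x p

subset-ext : ∀ {n} {p q : Subset n} → (∀ j → lookup p j ≡ lookup q j) → p ≡ q
subset-ext {p = p} {q} p≗q = trans (sym (tabulate∘lookup p)) (trans (tabulate-cong p≗q) (tabulate∘lookup q))

∃-member : ∀ {n} (p : Subset n) → 0 < ∣ p ∣ → ∃[ a ] lookup p a ≡ true
∃-member (true ∷ p)  _   = zero , refl
∃-member (false ∷ p) pos with ∃-member p pos
... | a , a∈p = suc a , a∈p

member⇒1≤∣p∣ : ∀ {n} (p : Subset n) {a} → lookup p a ≡ true → 1 ≤ ∣ p ∣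
member⇒1≤∣p∣ p {a} a∈p = subst₂ _≤_ (cong [_] a∈p) (sym (∣p∣≡∑χ p)) (term≤∑ (χ p) a)

∃-outside : ∀ {n} (p q : Subset n) → ∣ p ∩ q ∣ < ∣ p ∣ → ∃[ a ] (lookup p a ≡ true × lookup q a ≡ false)
∃-outside {n} p q small with ¬∀⟶∃¬ n (λ j → χ p j * χ q j ≡ χ p j) (λ j → χ p j * χ q j ≟ χ p j)
                                   (λ all → <-irrefl (trans (∣p∩q∣≡∑χχ p q) (trans (sum-cong-≗ all) (sym (∣p∣≡∑χ p)))) small)
... | a , a∉ with lookup p a in pa | lookup q a in qa
...   | true  | false = a , pa , qa
...   | true  | true  = ⊥-elim (a∉ refl)
...   | false | _     = ⊥-elim (a∉ refl)

∩-saturated⇒≡ : ∀ {n} (p q : Subset n) → ∣ p ∩ q ∣ ≡ ∣ p ∣ → ∣ p ∩ q ∣ ≡ ∣ q ∣ → p ≡ q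
∩-saturated⇒≡ p q ∩≡p ∩≡q = subset-ext (λ j → []-injective (trans (sym (∩-p j)) (∩-q j)))
  where
  ∩-p : ∀ j → χ p j * χ q j ≡ χ p j
  ∩-p = ∑-rigid (λ j → []*≤ˡ (lookup p j) (lookup q j))
          (trans (sym (∣p∩q∣≡∑χχ p q)) (trans ∩≡p (∣p∣≡∑χ p)))
  ∩-q : ∀ j → χ p j * χ q j ≡ χ q j
  ∩-q = ∑-rigid (λ j → []*≤ʳ (lookup p j) (lookup q j))
          (trans (sym (∣p∩q∣≡∑χχ p q)) (trans ∩≡q (∣p∣≡∑χ q)))

-- Part 2: distances in the Johnson graph.

exchange-bound-pointwise : ∀ u v x → [ v ] * [ x ] + [ u ] * [ v ] ≤ [ u ] * [ x ] + [ v ]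
exchange-bound-pointwise true  true  true  = ≤-refl
exchange-bound-pointwise true  true  false = ≤-refl
exchange-bound-pointwise false true  true  = ≤-refl
exchange-bound-pointwise false true  false = z≤n
exchange-bound-pointwise true  false _     = z≤n
exchange-bound-pointwise false false _     = z≤n

-- |V ∩ X| + |U ∩ V| ≤ |U ∩ X| + |V|: every point counted on the left lies
-- in V, and a point counted twice there also lies in U ∩ X.
exchange-bound : ∀ {n} (U V X : Subset n) → ∣ V ∩ X ∣ + ∣ U ∩ V ∣ ≤ ∣ U ∩ X ∣ + ∣ V ∣
exchange-bound U V X = subst₂ _≤_
  (trans (∑-distrib-+ (λ j → χ V j * χ X j) (λ j → χ U j * χ V j))
         (sym (cong₂ _+_ (∣p∩q∣≡∑χχ V X) (∣p∩q∣≡∑χχ U V))))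
  (trans (∑-distrib-+ (λ j → χ U j * χ X j) (χ V))
         (sym (cong₂ _+_ (∣p∩q∣≡∑χχ U X) (∣p∣≡∑χ V))))
  (∑-mono (λ j → exchange-bound-pointwise (lookup U j) (lookup V j) (lookup X j)))

overlap-step : ∀ {n k} {U V : Subset n} (X : Subset n) → Adj n k U V → ∣ V ∩ X ∣ ≤ suc ∣ U ∩ X ∣
overlap-step {k = k} {U} {V} X (_ , ∣V∣≡k , ∣U∩V∣≡k∸1) = +-cancelʳ-≤ (k ∸ 1) _ _ (begin
  ∣ V ∩ X ∣ + (k ∸ 1)       ≡⟨ cong (∣ V ∩ X ∣ +_) (sym ∣U∩V∣≡k∸1) ⟩
  ∣ V ∩ X ∣ + ∣ U ∩ V ∣     ≤⟨ exchange-bound U V X ⟩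
  ∣ U ∩ X ∣ + ∣ V ∣         ≡⟨ cong (∣ U ∩ X ∣ +_) ∣V∣≡k ⟩
  ∣ U ∩ X ∣ + k             ≤⟨ +-monoʳ-≤ ∣ U ∩ X ∣ (m≤n+m∸n k 1) ⟩
  ∣ U ∩ X ∣ + suc (k ∸ 1)   ≡⟨ +-suc ∣ U ∩ X ∣ (k ∸ 1) ⟩
  suc ∣ U ∩ X ∣ + (k ∸ 1)   ∎)
  where open ≤-Reasoning

walk-overlap : ∀ {n k U X m} → ∣ U ∣ ≡ k → Walk n k U X m → k ≤ ∣ U ∩ X ∣ + m
walk-overlap {k = k} {U} ∣U∣≡k here = ≤-reflexive (begin
  k               ≡⟨ sym ∣U∣≡k ⟩
  ∣ U ∣           ≡⟨ cong ∣_∣ (sym (∩-idem U)) ⟩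
  ∣ U ∩ U ∣       ≡⟨ sym (+-identityʳ _) ⟩
  ∣ U ∩ U ∣ + 0   ∎)
  where open ≡-Reasoning
walk-overlap {k = k} {U} {X} {suc m} _ (step {V = V} U~V@(_ , ∣V∣≡k , _) walk) = begin
  k                   ≤⟨ walk-overlap ∣V∣≡k walk ⟩
  ∣ V ∩ X ∣ + m       ≤⟨ +-monoˡ-≤ m (overlap-step {U = U} {V} X U~V) ⟩
  suc ∣ U ∩ X ∣ + m   ≡⟨ +-suc ∣ U ∩ X ∣ m ⟨
  ∣ U ∩ X ∣ + suc m   ∎
  where open ≤-Reasoning

-- Exchanging a point a ∈ U \ X for a point b ∈ X \ U gives a set V with
-- |V| = |U|, |U ∩ V| + 1 = |U| and |V ∩ X| = |U ∩ X| + 1, i.e. a neighbour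
-- of U in the Johnson graph that is one step closer to X.
module Exchange {n} (U X : Subset n) {a b : Fin n}
  (a∈U : lookup U a ≡ true) (a∉X : lookup X a ≡ false)
  (b∉U : lookup U b ≡ false) (b∈X : lookup X b ≡ true) where

  V : Subset n
  V = (U [ a ]≔ false) [ b ]≔ true

  a≢b : a ≢ b
  a≢b refl with trans (sym a∈U) b∉U
  ... | ()

  χV-a : χ V a ≡ 0
  χV-a = cong [_] (trans (lookup∘update′ a≢b (U [ a ]≔ false) true) (lookup∘update a U false))

  χV-b : χ V b ≡ 1
  χV-b = cong [_] (lookup∘update b (U [ a ]≔ false) true)

  χV-kept : ∀ {j} → a ≢ j → b ≢ j → χ V j ≡ χ U j
  χV-kept a≢j b≢j = cong [_] (trans (lookup∘update′ (b≢j ∘ sym) (U [ a ]≔ false) true)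
                                    (lookup∘update′ (a≢j ∘ sym) U false))

  data Site : Fin n → Set where
    removed : Site a
    added   : Site b
    kept    : ∀ {j} → a ≢ j → b ≢ j → Site j

  site : ∀ j → Site j
  site j with a ≟ᶠ j | b ≟ᶠ j
  ... | yes refl | _        = removed
  ... | no _     | yes refl = added
  ... | no a≢j   | no b≢j   = kept a≢j b≢j

  size-pointwise : ∀ j → χ V j + δ a j ≡ χ U j + δ b j
  size-pointwise j with site j
  ... | removed       = trans (cong₂ _+_ χV-a (δ-same a)) (sym (cong₂ _+_ (cong [_] a∈U) (δ-other (a≢b ∘ sym))))
  ... | added         = trans (cong₂ _+_ χV-b (δ-other a≢b)) (sym (cong₂ _+_ (cong [_] b∉U) (δ-same b)))
  ... | kept a≢j b≢j  = cong₂ _+_ (χV-kept a≢j b≢j) (trans (δ-other a≢j) (sym (δ-other b≢j)))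

  overlap-U-pointwise : ∀ j → χ U j * χ V j + δ a j ≡ χ U j
  overlap-U-pointwise j with site j
  ... | removed       = trans (cong₂ _+_ (cong₂ _*_ (cong [_] a∈U) χV-a) (δ-same a)) (sym (cong [_] a∈U))
  ... | added         = trans (cong₂ _+_ (cong₂ _*_ (cong [_] b∉U) χV-b) (δ-other a≢b)) (sym (cong [_] b∉U))
  ... | kept a≢j b≢j  = begin
    χ U j * χ V j + δ a j   ≡⟨ cong₂ _+_ (cong (χ U j *_) (χV-kept a≢j b≢j)) (δ-other a≢j) ⟩
    χ U j * χ U j + 0       ≡⟨ +-identityʳ _ ⟩
    χ U j * χ U j           ≡⟨ []-idem (lookup U j) ⟩
    χ U j                   ∎
    where open ≡-Reasoning

  overlap-X-pointwise : ∀ j → χ V j * χ X j ≡ χ U j * χ X j + δ b j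
  overlap-X-pointwise j with site j
  ... | removed       = trans (cong₂ _*_ χV-a (cong [_] a∉X))
                          (sym (cong₂ _+_ (cong₂ _*_ (cong [_] a∈U) (cong [_] a∉X)) (δ-other (a≢b ∘ sym))))
  ... | added         = trans (cong₂ _*_ χV-b (cong [_] b∈X))
                          (sym (cong₂ _+_ (cong₂ _*_ (cong [_] b∉U) (cong [_] b∈X)) (δ-same b)))
  ... | kept a≢j b≢j  = trans (cong (_* χ X j) (χV-kept a≢j b≢j))
                          (sym (trans (cong (χ U j * χ X j +_) (δ-other b≢j)) (+-identityʳ _)))

  size : ∣ V ∣ ≡ ∣ U ∣
  size = +-cancelʳ-≡ 1 _ _ (begin
    ∣ V ∣ + 1                        ≡⟨ cong (_+ 1) (∣p∣≡∑χ V) ⟩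
    sum (χ V) + 1                    ≡⟨ ∑-+δ a (χ V) ⟨
    sum (λ j → χ V j + δ a j)        ≡⟨ sum-cong-≗ size-pointwise ⟩
    sum (λ j → χ U j + δ b j)        ≡⟨ ∑-+δ b (χ U) ⟩
    sum (χ U) + 1                    ≡⟨ cong (_+ 1) (∣p∣≡∑χ U) ⟨
    ∣ U ∣ + 1                        ∎)
    where open ≡-Reasoning

  overlap-U : ∣ U ∩ V ∣ + 1 ≡ ∣ U ∣
  overlap-U = begin
    ∣ U ∩ V ∣ + 1                          ≡⟨ cong (_+ 1) (∣p∩q∣≡∑χχ U V) ⟩
    sum (λ j → χ U j * χ V j) + 1          ≡⟨ ∑-+δ a (λ j → χ U j * χ V j) ⟨
    sum (λ j → χ U j * χ V j + δ a j)      ≡⟨ sum-cong-≗ overlap-U-pointwise ⟩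
    sum (χ U)                              ≡⟨ ∣p∣≡∑χ U ⟨
    ∣ U ∣                                  ∎
    where open ≡-Reasoning

  overlap-X : ∣ V ∩ X ∣ ≡ ∣ U ∩ X ∣ + 1
  overlap-X = begin
    ∣ V ∩ X ∣                              ≡⟨ ∣p∩q∣≡∑χχ V X ⟩
    sum (λ j → χ V j * χ X j)              ≡⟨ sum-cong-≗ overlap-X-pointwise ⟩
    sum (λ j → χ U j * χ X j + δ b j)      ≡⟨ ∑-+δ b (λ j → χ U j * χ X j) ⟩
    sum (λ j → χ U j * χ X j) + 1          ≡⟨ cong (_+ 1) (∣p∩q∣≡∑χχ U X) ⟨
    ∣ U ∩ X ∣ + 1                          ∎
    where open ≡-Reasoning

walk-exists : ∀ {n k} d (U X : Subset n) → ∣ U ∣ ≡ k → ∣ X ∣ ≡ k → d + ∣ U ∩ X ∣ ≡ k → Walk n k U X d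
walk-exists {n} {k} zero U X ∣U∣≡k ∣X∣≡k ∣U∩X∣≡k =
  subst (λ Y → Walk n k U Y zero) (∩-saturated⇒≡ U X (trans ∣U∩X∣≡k (sym ∣U∣≡k)) (trans ∣U∩X∣≡k (sym ∣X∣≡k))) here
walk-exists {n} {k} (suc d) U X ∣U∣≡k ∣X∣≡k d+1+c≡k =
  step (∣U∣≡k , ∣V∣≡k , ∣U∩V∣≡k∸1) (walk-exists d V X ∣V∣≡k ∣X∣≡k d+c+1≡k)
  where
  c<k : ∣ U ∩ X ∣ < k
  c<k = subst (∣ U ∩ X ∣ <_) d+1+c≡k (s≤s (m≤n+m ∣ U ∩ X ∣ d))
  outU = ∃-outside U X (subst (∣ U ∩ X ∣ <_) (sym ∣U∣≡k) c<k)
  outX = ∃-outside X U (subst₂ _<_ (cong ∣_∣ (∩-comm U X)) (sym ∣X∣≡k) c<k)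
  open Exchange U X (proj₁ (proj₂ outU)) (proj₂ (proj₂ outU)) (proj₂ (proj₂ outX)) (proj₁ (proj₂ outX))
  ∣V∣≡k : ∣ V ∣ ≡ k
  ∣V∣≡k = trans size ∣U∣≡k
  ∣U∩V∣≡k∸1 : ∣ U ∩ V ∣ ≡ k ∸ 1
  ∣U∩V∣≡k∸1 = trans (sym (m+n∸n≡m ∣ U ∩ V ∣ 1)) (cong (_∸ 1) (trans overlap-U ∣U∣≡k))
  d+c+1≡k : d + ∣ V ∩ X ∣ ≡ k
  d+c+1≡k = trans (cong (d +_) (trans overlap-X (+-comm ∣ U ∩ X ∣ 1))) (trans (+-suc d ∣ U ∩ X ∣) d+1+c≡k)

distance-formula : ∀ {n k U X d} → ∣ U ∣ ≡ k → ∣ X ∣ ≡ k → Dist n k U X d → d + ∣ U ∩ X ∣ ≡ k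
distance-formula {n} {k} {U} {X} {d} ∣U∣≡k ∣X∣≡k (walk , shortest) =
  ≤-antisym d+c≤k (subst (k ≤_) (+-comm ∣ U ∩ X ∣ d) (walk-overlap ∣U∣≡k walk))
  where
  c≤k : ∣ U ∩ X ∣ ≤ k
  c≤k = subst (∣ U ∩ X ∣ ≤_) ∣U∣≡k (∣p∩q∣≤∣p∣ U X)
  d≤k∸c : d ≤ k ∸ ∣ U ∩ X ∣
  d≤k∸c = ≮⇒≥ (λ k∸c<d → shortest (k ∸ ∣ U ∩ X ∣) k∸c<d
                            (walk-exists (k ∸ ∣ U ∩ X ∣) U X ∣U∣≡k ∣X∣≡k (m∸n+n≡m c≤k)))
  d+c≤k : d + ∣ U ∩ X ∣ ≤ k
  d+c≤k = subst (d + ∣ U ∩ X ∣ ≤_) (m∸n+n≡m c≤k) (+-monoˡ-≤ ∣ U ∩ X ∣ d≤k∸c)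

m*k≡m*n⇒m≡0 : ∀ {m k n} → k < n → m * k ≡ m * n → m ≡ 0
m*k≡m*n⇒m≡0 {zero}  _   _ = refl
m*k≡m*n⇒m≡0 {suc m} k<n e = ⊥-elim (<⇒≢ k<n (*-cancelˡ-≡ _ _ (suc m) e))

m*k≡m⇒m≡0 : ∀ {m k} → 1 < k → m * k ≡ m → m ≡ 0
m*k≡m⇒m≡0 {zero}  _   _ = refl
m*k≡m⇒m≡0 {suc m} 1<k e = ⊥-elim (<-irrefl (sym e) (m<m*n (suc m) _ 1<k))

-- Part 3: double counting in a 2-(n,k,λ) design with b blocks.
module DesignCounting {n k lam b : ℕ} {B : Fin b → Subset n} (design : IsDesign n k lam b B) where
  open IsDesign design

  r : Fin n → ℕ
  r x = ∑[ i < b ] χ (B i) x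

  joint : Fin n → Fin n → ℕ
  joint x y = ∑[ i < b ] (χ (B i) x * χ (B i) y)

  joint-diag : ∀ x → joint x x ≡ r x
  joint-diag x = sum-cong-≗ (λ i → []-idem (lookup (B i) x))

  joint-off : ∀ {x y} → x ≢ y → joint x y ≡ lam
  joint-off {x} {y} x≢y = trans (sym pairCount≡joint) (balanced x y x≢y)
    where
    membership : Fin b → Bool
    membership i = does (x ∈? B i) ∧ does (y ∈? B i)
    pairCount≡joint : pairCount B x y ≡ joint x y
    pairCount≡joint = trans (∣p∣≡∑χ (tabulate membership)) (sum-cong-≗ (λ i → begin
      [ lookup (tabulate membership) i ]        ≡⟨ cong [_] (lookup∘tabulate membership i) ⟩
      [ does (x ∈? B i) ∧ does (y ∈? B i) ]     ≡⟨ []-∧ (does (x ∈? B i)) (does (y ∈? B i)) ⟩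
      [ does (x ∈? B i) ] * [ does (y ∈? B i) ] ≡⟨ cong₂ (λ u v → [ u ] * [ v ]) (does-∈? x (B i)) (does-∈? y (B i)) ⟩
      χ (B i) x * χ (B i) y                     ∎))
      where open ≡-Reasoning

  profile : Fin n → Subset n → ℕ
  profile x S = ∑[ i < b ] (χ (B i) x * ∣ S ∩ B i ∣)

  -- Counting pairs (y ∈ S, block through x and y) in two orders.
  profile≡∑joint : ∀ x S → profile x S ≡ ∑[ y < n ] (χ S y * joint x y)
  profile≡∑joint x S = begin
    ∑[ i < b ] (χ (B i) x * ∣ S ∩ B i ∣)                     ≡⟨ sum-cong-≗ (λ i → cong (χ (B i) x *_) (∣p∩q∣≡∑χχ S (B i))) ⟩
    ∑[ i < b ] (χ (B i) x * ∑[ y < n ] (χ S y * χ (B i) y))   ≡⟨ sum-cong-≗ (λ i → *-distribˡ-sum (χ (B i) x) (λ y → χ S y * χ (B i) y)) ⟩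
    ∑[ i < b ] ∑[ y < n ] (χ (B i) x * (χ S y * χ (B i) y))   ≡⟨ ∑-comm (λ i y → χ (B i) x * (χ S y * χ (B i) y)) ⟩
    ∑[ y < n ] ∑[ i < b ] (χ (B i) x * (χ S y * χ (B i) y))   ≡⟨ sum-cong-≗ (λ y → sum-cong-≗ (λ i → regroup (χ (B i) x) (χ S y) (χ (B i) y))) ⟩
    ∑[ y < n ] ∑[ i < b ] (χ S y * (χ (B i) x * χ (B i) y))   ≡⟨ sum-cong-≗ (λ y → *-distribˡ-sum (χ S y) (λ i → χ (B i) x * χ (B i) y)) ⟨
    ∑[ y < n ] (χ S y * joint x y)                            ∎
    where
    open ≡-Reasoning
    regroup : ∀ u s v → u * (s * v) ≡ s * (u * v)
    regroup = solve-∀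

  -- joint x y = r x if y = x and λ otherwise, written without subtraction.
  joint-pointwise : ∀ x y s → s * joint x y + lam * (δ x y * s) ≡ r x * (δ x y * s) + lam * s
  joint-pointwise x y s with x ≟ᶠ y
  ... | yes refl = trans (cong (λ j → s * j + lam * (1 * s)) (joint-diag x)) (diagonal s (r x) lam)
    where
    diagonal : ∀ s r l → s * r + l * (1 * s) ≡ r * (1 * s) + l * s
    diagonal = solve-∀
  ... | no x≢y   = trans (cong (λ j → s * j + lam * (0 * s)) (joint-off x≢y)) (off-diagonal s (r x) lam)
    where
    off-diagonal : ∀ s r l → s * l + l * (0 * s) ≡ r * (0 * s) + l * s
    off-diagonal = solve-∀

  incidence-identity : ∀ x S → profile x S + lam * χ S x ≡ r x * χ S x + lam * ∣ S ∣
  incidence-identity x S = begin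
    profile x S + lam * χ S x
      ≡⟨ cong₂ _+_ (profile≡∑joint x S) (cong (lam *_) (sym (∑-δ x (χ S)))) ⟩
    ∑[ y < n ] (χ S y * joint x y) + lam * ∑[ y < n ] (δ x y * χ S y)
      ≡⟨ cong (∑[ y < n ] (χ S y * joint x y) +_) (*-distribˡ-sum lam (λ y → δ x y * χ S y)) ⟩
    ∑[ y < n ] (χ S y * joint x y) + ∑[ y < n ] (lam * (δ x y * χ S y))
      ≡⟨ ∑-distrib-+ (λ y → χ S y * joint x y) (λ y → lam * (δ x y * χ S y)) ⟨
    ∑[ y < n ] (χ S y * joint x y + lam * (δ x y * χ S y))
      ≡⟨ sum-cong-≗ (λ y → joint-pointwise x y (χ S y)) ⟩
    ∑[ y < n ] (r x * (δ x y * χ S y) + lam * χ S y)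
      ≡⟨ ∑-distrib-+ (λ y → r x * (δ x y * χ S y)) (λ y → lam * χ S y) ⟩
    ∑[ y < n ] (r x * (δ x y * χ S y)) + ∑[ y < n ] (lam * χ S y)
      ≡⟨ cong₂ _+_ (*-distribˡ-sum (r x) (λ y → δ x y * χ S y)) (*-distribˡ-sum lam (χ S)) ⟨
    r x * ∑[ y < n ] (δ x y * χ S y) + lam * sum (χ S)
      ≡⟨ cong₂ _+_ (cong (r x *_) (∑-δ x (χ S))) (cong (lam *_) (sym (∣p∣≡∑χ S))) ⟩
    r x * χ S x + lam * ∣ S ∣
      ∎
    where open ≡-Reasoning

  profile-∈ : ∀ {x S} → lookup S x ≡ true → profile x S + lam ≡ r x + lam * ∣ S ∣
  profile-∈ {x} {S} x∈S = begin
    profile x S + lam            ≡⟨ cong (profile x S +_) (*-identityʳ lam) ⟨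
    profile x S + lam * 1        ≡⟨ cong (λ t → profile x S + lam * [ t ]) x∈S ⟨
    profile x S + lam * χ S x    ≡⟨ incidence-identity x S ⟩
    r x * χ S x + lam * ∣ S ∣    ≡⟨ cong (λ t → r x * [ t ] + lam * ∣ S ∣) x∈S ⟩
    r x * 1 + lam * ∣ S ∣        ≡⟨ cong (_+ lam * ∣ S ∣) (*-identityʳ (r x)) ⟩
    r x + lam * ∣ S ∣            ∎
    where open ≡-Reasoning

  profile-∉ : ∀ {x S} → lookup S x ≡ false → profile x S ≡ lam * ∣ S ∣
  profile-∉ {x} {S} x∉S = begin
    profile x S                  ≡⟨ +-identityʳ (profile x S) ⟨
    profile x S + 0              ≡⟨ cong (profile x S +_) (*-zeroʳ lam) ⟨
    profile x S + lam * 0        ≡⟨ cong (λ t → profile x S + lam * [ t ]) x∉S ⟨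
    profile x S + lam * χ S x    ≡⟨ incidence-identity x S ⟩
    r x * χ S x + lam * ∣ S ∣    ≡⟨ cong (λ t → r x * [ t ] + lam * ∣ S ∣) x∉S ⟩
    r x * 0 + lam * ∣ S ∣        ≡⟨ cong (_+ lam * ∣ S ∣) (*-zeroʳ (r x)) ⟩
    lam * ∣ S ∣                  ∎
    where open ≡-Reasoning

  replication : ∀ x → r x * k + lam ≡ r x + lam * n
  replication x = begin
    r x * k + lam          ≡⟨ cong (_+ lam) profile-⊤ ⟨
    profile x ⊤ + lam      ≡⟨ profile-∈ {S = ⊤} (lookup-replicate x true) ⟩
    r x + lam * ∣ ⊤ {n} ∣  ≡⟨ cong (λ m → r x + lam * m) (∣⊤∣≡n n) ⟩
    r x + lam * n          ∎
    where
    open ≡-Reasoning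
    profile-⊤ : profile x ⊤ ≡ r x * k
    profile-⊤ = trans (sum-cong-≗ (λ i → cong (χ (B i) x *_) (trans (cong ∣_∣ (∩-identityˡ (B i))) (blockSize i))))
                      (sym (*-distribʳ-sum k (λ i → χ (B i) x)))

  equal-profiles⇒r≡λ : ∀ {x U W} → lookup U x ≡ true → lookup W x ≡ false → ∣ U ∣ ≡ ∣ W ∣ →
                       (∀ i → ∣ U ∩ B i ∣ ≡ ∣ W ∩ B i ∣) → r x ≡ lam
  equal-profiles⇒r≡λ {x} {U} {W} x∈U x∉W ∣U∣≡∣W∣ same = +-cancelˡ-≡ (lam * ∣ W ∣) (r x) lam (begin
    lam * ∣ W ∣ + r x      ≡⟨ +-comm (lam * ∣ W ∣) (r x) ⟩
    r x + lam * ∣ W ∣      ≡⟨ cong (λ m → r x + lam * m) ∣U∣≡∣W∣ ⟨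
    r x + lam * ∣ U ∣      ≡⟨ profile-∈ {S = U} x∈U ⟨
    profile x U + lam      ≡⟨ cong (_+ lam) (sum-cong-≗ (λ i → cong (χ (B i) x *_) (same i))) ⟩
    profile x W + lam      ≡⟨ cong (_+ lam) (profile-∉ {S = W} x∉W) ⟩
    lam * ∣ W ∣ + lam      ∎)
    where open ≡-Reasoning

  r≡λ⇒λ≡0 : ∀ x → r x ≡ lam → lam ≡ 0
  r≡λ⇒λ≡0 x r≡λ = m*k≡m*n⇒m≡0 k<n (+-cancelʳ-≡ lam (lam * k) (lam * n) (begin
    lam * k + lam          ≡⟨ cong (λ t → t * k + lam) r≡λ ⟨
    r x * k + lam          ≡⟨ replication x ⟩
    r x + lam * n          ≡⟨ cong (_+ lam * n) r≡λ ⟩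
    lam + lam * n          ≡⟨ +-comm lam (lam * n) ⟩
    lam * n + lam          ∎))
    where open ≡-Reasoning

  -- A design with λ = 0 and at least one block has blocks of size ≤ 1:
  -- otherwise r_y k = r_y forces every r_y = 0, so every block is empty.
  λ≡0⇒k≤1 : lam ≡ 0 → Fin b → k ≤ 1
  λ≡0⇒k≤1 λ≡0 i₀ = ≮⇒≥ (λ 1<k → <⇒≢ (<-trans (s≤s z≤n) 1<k) (sym (block-empty 1<k)))
    where
    unreplicated : 1 < k → ∀ y → r y ≡ 0
    unreplicated 1<k y = m*k≡m⇒m≡0 1<k
      (+-cancelʳ-≡ lam _ _ (trans (replication y) (cong (r y +_) (trans (cong (_* n) λ≡0) (sym λ≡0)))))
    block-empty : 1 < k → k ≡ 0
    block-empty 1<k = n≤0⇒n≡0 (begin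
      k                    ≡⟨ blockSize i₀ ⟨
      ∣ B i₀ ∣             ≡⟨ ∣p∣≡∑χ (B i₀) ⟩
      sum (χ (B i₀))       ≤⟨ ∑-mono (λ y → subst (χ (B i₀) y ≤_) (unreplicated 1<k y) (term≤∑ (λ i → χ (B i) y) i₀)) ⟩
      sum {n} (λ _ → 0)    ≡⟨ sum-replicate-zero n ⟩
      0                    ∎)
      where open ≤-Reasoning

injective⇒hits : ∀ {n} (f : Fin n → Fin n) → Injective _≡_ _≡_ f → ∀ x → ¬ (∀ i → f i ≢ x)
injective⇒hits {suc m} f f-inj x misses = 1+n≰n (injective⇒≤ g-inj)
  where
  g : Fin (suc m) → Fin m
  g i = punchOut (misses i ∘ sym)
  g-inj : Injective _≡_ _≡_ g
  g-inj {i} {j} gi≡gj = f-inj (punchOut-injective (misses i ∘ sym) (misses j ∘ sym) gi≡gj)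

-- n distinct 1-subsets of an n-set cover all of its points: choosing the
-- element of each block is injective, hence misses nothing.
singletons-cover : ∀ {n} (B : Fin n → Subset n) → Injective _≡_ _≡_ B → (∀ i → ∣ B i ∣ ≡ 1) →
                   ∀ x → ¬ (∀ i → lookup (B i) x ≡ false)
singletons-cover {n} B B-inj singleton x uncovered = injective⇒hits element element-inj x element≢x
  where
  member : ∀ i → ∃[ y ] lookup (B i) y ≡ true
  member i = ∃-member (B i) (subst (0 <_) (sym (singleton i)) (s≤s z≤n))
  element : Fin n → Fin n
  element i = proj₁ (member i)
  element≢x : ∀ i → element i ≢ x
  element≢x i refl with trans (sym (proj₂ (member i))) (uncovered i)
  ... | ()
  element-inj : Injective _≡_ _≡_ element
  element-inj {i} {j} same = B-inj (∩-saturated⇒≡ (B i) (B j) (trans meet (sym (singleton i))) (trans meet (sym (singleton j))))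
    where
    common : lookup (B i ∩ B j) (element i) ≡ true
    common = trans (lookup-zipWith _∧_ (element i) (B i) (B j))
                   (cong₂ _∧_ (proj₂ (member i)) (trans (cong (lookup (B j)) same) (proj₂ (member j))))
    meet : ∣ B i ∩ B j ∣ ≡ 1
    meet = ≤-antisym (subst (∣ B i ∩ B j ∣ ≤_) (singleton i) (∣p∩q∣≤∣p∣ (B i) (B j)))
                     (member⇒1≤∣p∣ (B i ∩ B j) common)

-- In a symmetric design with k ≥ 1 no point lies on exactly λ blocks:
-- that would force λ = 0, hence k = 1, and then the n singleton blocks
-- would cover the point after all.
replication≢λ : ∀ {n k lam} {B : Fin n → Subset n} (design : IsSymmetricDesign n k lam B) →
                1 ≤ k → ∀ x → DesignCounting.r design x ≢ lam
replication≢λ {n} {k} {lam} {B} design 1≤k x r≡λ = singletons-cover B distinct singleton x uncovered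
  where
  open IsDesign design
  open DesignCounting design
  λ≡0 : lam ≡ 0
  λ≡0 = r≡λ⇒λ≡0 x r≡λ
  singleton : ∀ i → ∣ B i ∣ ≡ 1
  singleton i = trans (blockSize i) (≤-antisym (λ≡0⇒k≤1 λ≡0 (fromℕ< k<n)) 1≤k)
  uncovered : ∀ i → lookup (B i) x ≡ false
  uncovered i = []-injective (n≤0⇒n≡0 (≤-trans (term≤∑ (λ i → χ (B i) x) i) (≤-reflexive (trans r≡λ λ≡0))))

distinguishing-point : ∀ {n} (U W : Subset n) → U ≢ W →
  ∃[ x ] ((lookup U x ≡ true × lookup W x ≡ false) ⊎ (lookup W x ≡ true × lookup U x ≡ false))
distinguishing-point {n} U W U≢W
  with ¬∀⟶∃¬ n (λ j → lookup U j ≡ lookup W j) (λ j → lookup U j Bool.≟ lookup W j) (U≢W ∘ subset-ext)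
... | x , differ with lookup U x in Ux | lookup W x in Wx
...   | true  | false = x , inj₁ (Ux , Wx)
...   | false | true  = x , inj₂ (Wx , Ux)
...   | true  | true  = ⊥-elim (differ refl)
...   | false | false = ⊥-elim (differ refl)

blocks-separate : ∀ {n k lam} {B : Fin n → Subset n} → IsSymmetricDesign n k lam B →
                  ∀ {U W} → ∣ U ∣ ≡ k → ∣ W ∣ ≡ k → U ≢ W → ¬ (∀ i → ∣ U ∩ B i ∣ ≡ ∣ W ∩ B i ∣)
blocks-separate design {U} {W} ∣U∣≡k ∣W∣≡k U≢W same with distinguishing-point U W U≢W
... | x , inj₁ (x∈U , x∉W) =
  replication≢λ design (subst (1 ≤_) ∣U∣≡k (member⇒1≤∣p∣ U x∈U)) x
    (DesignCounting.equal-profiles⇒r≡λ design {U = U} {W} x∈U x∉W (trans ∣U∣≡k (sym ∣W∣≡k)) same)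
... | x , inj₂ (x∈W , x∉U) =
  replication≢λ design (subst (1 ≤_) ∣W∣≡k (member⇒1≤∣p∣ W x∈W)) x
    (DesignCounting.equal-profiles⇒r≡λ design {U = W} {U} x∈W x∉U (trans ∣W∣≡k (sym ∣U∣≡k)) (sym ∘ same))

-- Theorem 3.4.  The blocks of a symmetric design resolve J(n,k): a block
-- B with |U ∩ B| ≠ |W ∩ B| has d(U,B) = k - |U ∩ B| ≠ k - |W ∩ B| = d(W,B).
theorem3p4 : (n k lam : ℕ) (B : Fin n → Subset n) → IsSymmetricDesign n k lam B →
    IsResolving n k (λ X → ∃[ i ] B i ≡ X)
theorem3p4 n k lam B design U W ∣U∣≡k ∣W∣≡k U≢W = B i , (i , refl) , distances-differ
  where
  open IsDesign design using (blockSize)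
  separating : ∃[ i ] ∣ U ∩ B i ∣ ≢ ∣ W ∩ B i ∣
  separating = ¬∀⟶∃¬ n _ (λ i → ∣ U ∩ B i ∣ ≟ ∣ W ∩ B i ∣) (blocks-separate design ∣U∣≡k ∣W∣≡k U≢W)
  i : Fin n
  i = proj₁ separating
  distances-differ : ∀ d₁ d₂ → Dist n k U (B i) d₁ → Dist n k W (B i) d₂ → ¬ d₁ ≡ d₂
  distances-differ d .d dU dW refl = proj₂ separating (+-cancelˡ-≡ d _ _
    (trans (distance-formula ∣U∣≡k (blockSize i) dU) (sym (distance-formula ∣W∣≡k (blockSize i) dW))))
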